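{- Let $G=(V,E)$ be a simple graph with $n=|V|$ vertices. Then: (1) $\bar{\gamma}_p(G)=n-1$ if and only if $G$ has an isolated vertex. (2) $\bar{\gamma}_p(G)=n-2$ if and only if $G$ has a connected component isomorphic to $K_2$ and has no isolated vertices. (3) $\bar{\gamma}_p(G)=n-3$ if and only if $G$ has no connected component that is an isolated vertex or $K_2$, and $G$ contains as an induced subgraph either a path $P_3$ in which only the middle vertex may be adjacent to other vertices of $V$, or a triangle $K_3$ in which at most one of the three vertices may be adjacent to other vertices of $V$.
   Context: For $v\in V$, $N[v]$ is the closed neighborhood; for $S\subseteq V$, $N[S]=\bigcup_{v\in S}N[v]$. Define $\mathcal{P}^0(S)=N[S]$, $\mathcal{P}^{i+1}(S)=\mathcal{P}^i(S)\cup\{w : \{w\}=N[v]\setminus\mathcal{P}^i(S)\text{ for some } v\in\mathcal{P}^i(S)\}$, with eventual value $\mathcal{P}^\infty(S)$. $S$ is a power dominating set (PDS) if $\mathcal{P}^\infty(S)=V$, and a failed power dominating set (FPDS) otherwise. The failed power domination number $\bar{\gamma}_p(G)$ is the maximum cardinality of an FPDS of $G$. -}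

module Defs where

open import Data.Nat using (ℕ; zero; suc; _≤_)
open import Data.Fin using (Fin)
open import Data.Fin.Subset using (Subset; _∈_; ∣_∣)
open import Data.Bool using (Bool; true; false)
open import Data.Product using (Σ; ∃; _×_; _,_)
open import Data.Sum using (_⊎_)
open import Relation.Nullary using (¬_)
open import Relation.Binary.PropositionalEquality using (_≡_; _≢_)

record SimpleGraph (n : ℕ) : Set where
  field
    Adj   : Fin n → Fin n → Bool
    sym   : ∀ u v → Adj u v ≡ Adj v u
    irref : ∀ v → Adj v v ≡ false
open SimpleGraph public

module _ {n : ℕ} (G : SimpleGraph n) where

  InN[_] : Fin n → Fin n → Set
  InN[ v ] w = w ≡ v ⊎ Adj G v w ≡ true

  P : ℕ → Subset n → Fin n → Set
  P zero    S w = ∃ λ v → v ∈ S × InN[ v ] w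
  P (suc i) S w =
    P i S w ⊎
    (∃ λ v → P i S v × InN[ v ] w × ¬ P i S w ×
             (∀ u → InN[ v ] u → ¬ P i S u → u ≡ w))

  -- P^∞(S) = ⋃_i P^i(S)  (the sequence is increasing)
  P∞ : Subset n → Fin n → Set
  P∞ S w = ∃ λ i → P i S w

  IsPDS : Subset n → Set
  IsPDS S = ∀ w → P∞ S w

  IsFPDS : Subset n → Set
  IsFPDS S = ∃ λ w → ¬ P∞ S w

  IsFailedPDNumber : ℕ → Set
  IsFailedPDNumber m =
    (∃ λ S → IsFPDS S × ∣ S ∣ ≡ m) × (∀ S → IsFPDS S → ∣ S ∣ ≤ m)

  HasIsolatedVertex : Set
  HasIsolatedVertex = ∃ λ v → ∀ w → Adj G v w ≡ false

  K2Component : Fin n → Fin n → Set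
  K2Component u v =
    Adj G u v ≡ true ×
    (∀ w → Adj G u w ≡ true → w ≡ v) ×
    (∀ w → Adj G v w ≡ true → w ≡ u)

  HasK2Component : Set
  HasK2Component = ∃ λ u → ∃ λ v → K2Component u v

  PendantP3 : Fin n → Fin n → Fin n → Set
  PendantP3 a b c =
    a ≢ c ×
    Adj G a b ≡ true × Adj G b c ≡ true × Adj G a c ≡ false ×
    (∀ w → Adj G a w ≡ true → w ≡ b) ×
    (∀ w → Adj G c w ≡ true → w ≡ b)

  PendantK3 : Fin n → Fin n → Fin n → Set
  PendantK3 a b c =
    Adj G a b ≡ true × Adj G b c ≡ true × Adj G a c ≡ true ×
    (∀ w → Adj G a w ≡ true → w ≡ b ⊎ w ≡ c) ×
    (∀ w → Adj G b w ≡ true → w ≡ a ⊎ w ≡ c)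

  HasPendantP3orK3 : Set
  HasPendantP3orK3 =
    ∃ λ a → ∃ λ b → ∃ λ c → PendantP3 a b c ⊎ PendantK3 a b c

module Submission where

-- A fort is a set B of vertices such that no vertex outside B has
-- exactly one neighbour in B.  A fort disjoint from N[S] is never observed, because
-- only a vertex with a single unobserved neighbour can force.  An isolated vertex, a
-- K₂ component, the two ends of a pendant P₃ and the two private vertices of a pendant
-- K₃ are forts whose closed neighbourhoods have 1, 2, 3 and 3 vertices; omitting those
-- vertices gives FPDSs of size n - 1, n - 2, n - 3, whence lower bounds on m.
--
-- Let S be an FPDS of size n - k with unobserved vertex w.  Then w lies
-- outside N[S], so w and its neighbours lie outside S; counting shows that w, a
-- neighbour v of w (k ≥ 2) and one further vertex c (k = 3) are all the vertices
-- outside S.  An observed vertex next to an unobserved one must have a second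
-- neighbour outside N[S] (else it forces); applying this to v and c pins down the
-- structure for k = 1, 2, 3.

open import Defs
open import Data.Nat using (ℕ; zero; suc; _+_; _≤_; _<_; z≤n; s≤s)
open import Data.Nat.Properties
  using (≤-trans; ≤-reflexive; ≤-antisym; n≤1+n; n<1+n; m+[n∸m]≡n; +-monoʳ-≤; +-monoˡ-≤;
         <-irrefl; <⇒≱; +-suc; +-cancelˡ-≤; ≤∧≢⇒<)
open import Data.Fin using (Fin; zero; suc; _≟_)
open import Data.Fin.Properties using (¬∀⟶∃¬; any?)
open import Data.Fin.Subset
  using (Subset; _∈_; _∉_; ∣_∣; ∁; _-_; _─_; ⁅_⁆; ⊤; inside; outside) renaming (⊥ to ∅)
open import Data.Fin.Subset.Properties
  using (_∈?_; p─q⊆p; p─⊥≡p; x∈p∧x≢y⇒x∈p-y; x∈p⇒∣p-x∣<∣p∣; x∈⁅x⁆; ∈⊤; p⊆q⇒∣p∣≤∣q∣; ∣⊥∣≡0;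
         ∣∁p∣≡n∸∣p∣; ∣p∣≤n; x∉p⇒x∈∁p; x∈∁p⇒x∉p)
open import Data.Vec using (_∷_; here; there)
open import Data.Bool using (true; false)
open import Data.Bool.Properties using (¬-not) renaming (_≟_ to _≟ᵇ_)
open import Data.List using (List; []; _∷_; length)
open import Data.List.Membership.Propositional using () renaming (_∈_ to _∈ˡ_; _∉_ to _∉ˡ_)
open import Data.List.Membership.Propositional.Properties using (∈-++⁺ˡ)
import Data.List.Membership.DecPropositional as DecMembership
open import Data.List.Relation.Unary.Any using (here; there)
open import Data.List.Relation.Unary.All using (All; []; _∷_)
import Data.List.Relation.Unary.All as All
open import Data.List.Relation.Unary.All.Properties using (¬Any⇒All¬)
open import Data.List.Relation.Unary.AllPairs using ([]; _∷_)
open import Data.List.Relation.Unary.Unique.Propositional using (Unique)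
open import Data.Product using (∃; _×_; _,_; proj₁; proj₂)
open import Data.Sum using (_⊎_; inj₁; inj₂; swap)
open import Data.Empty using (⊥; ⊥-elim)
open import Relation.Nullary using (¬_; yes; no)
open import Relation.Nullary.Decidable using (decidable-stable; ¬?; _→-dec_; _×-dec_; _⊎-dec_)
open import Relation.Unary using (Decidable)
open import Relation.Binary.PropositionalEquality
  using (_≡_; _≢_; refl; trans; cong; subst) renaming (sym to ≡-sym)
open import Function using (_∘_; id)
open import Function.Bundles using (_⇔_; mk⇔; Equivalence)

-- Counting.  Subsets of the vertex set Fin n are compared with lists of vertices.

private variable
  n : ℕ

x∈p─q⇒x∉q : ∀ (p q : Subset n) {x} → x ∈ p ─ q → x ∉ q
x∈p─q⇒x∉q (inside ∷ p)  (outside ∷ q) here      ()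
x∈p─q⇒x∉q (_ ∷ p)       (_ ∷ q)       (there m) (there m') = x∈p─q⇒x∉q p q m m'

∣p∣≤1+∣p-x∣ : ∀ (p : Subset n) x → ∣ p ∣ ≤ suc ∣ p - x ∣
∣p∣≤1+∣p-x∣ (inside  ∷ p) zero    = ≤-reflexive (cong suc (≡-sym (cong ∣_∣ (p─⊥≡p p))))
∣p∣≤1+∣p-x∣ (outside ∷ p) zero    = ≤-trans (≤-reflexive (≡-sym (cong ∣_∣ (p─⊥≡p p)))) (n≤1+n _)
∣p∣≤1+∣p-x∣ (inside  ∷ p) (suc x) = s≤s (∣p∣≤1+∣p-x∣ p x)
∣p∣≤1+∣p-x∣ (outside ∷ p) (suc x) = ∣p∣≤1+∣p-x∣ p x

distinct-members-bound : ∀ (T : Subset n) {xs} → Unique xs → All (_∈ T) xs → length xs ≤ ∣ T ∣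
distinct-members-bound T         []               []           = z≤n
distinct-members-bound T {x ∷ xs} (x∉xs ∷ unique) (x∈T ∷ xs∈T) =
  ≤-trans (s≤s (distinct-members-bound (T - x) unique (still-in x∉xs xs∈T))) (x∈p⇒∣p-x∣<∣p∣ x∈T)
  where
  still-in : ∀ {ys} → All (λ y → x ≢ y) ys → All (_∈ T) ys → All (_∈ T - x) ys
  still-in []            []            = []
  still-in (x≢y ∷ x≢ys) (y∈T ∷ ys∈T) =
    x∈p∧x≢y⇒x∈p-y y∈T (λ y≡x → x≢y (≡-sym y≡x)) ∷ still-in x≢ys ys∈T

covered-bound : ∀ (T : Subset n) xs → (∀ {y} → y ∈ T → y ∈ˡ xs) → ∣ T ∣ ≤ length xs
covered-bound {n} T []       T⊆xs =
  ≤-trans (p⊆q⇒∣p∣≤∣q∣ {q = ∅} (λ y∈T → ⊥-elim (∉[] (T⊆xs y∈T)))) (≤-reflexive (∣⊥∣≡0 n))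
  where
  ∉[] : ∀ {y : Fin n} → y ∉ˡ []
  ∉[] ()
covered-bound T (x ∷ xs) T⊆xs = ≤-trans (∣p∣≤1+∣p-x∣ T x) (s≤s (covered-bound (T - x) xs T-x⊆xs))
  where
  T-x⊆xs : ∀ {y} → y ∈ T - x → y ∈ˡ xs
  T-x⊆xs y∈T-x with T⊆xs (p─q⊆p T ⁅ x ⁆ y∈T-x)
  ... | here refl = ⊥-elim (x∈p─q⇒x∉q T ⁅ x ⁆ y∈T-x (x∈⁅x⁆ x))
  ... | there y∈xs = y∈xs

complement-size : ∀ (S : Subset n) → ∣ S ∣ + ∣ ∁ S ∣ ≡ n
complement-size S = trans (cong (∣ S ∣ +_) (∣∁p∣≡n∸∣p∣ S)) (m+[n∸m]≡n (∣p∣≤n S))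

outside-bound : ∀ (S : Subset n) {xs} → Unique xs → All (_∉ S) xs → ∣ S ∣ + length xs ≤ n
outside-bound S unique xs∉S =
  ≤-trans (+-monoʳ-≤ ∣ S ∣ (distinct-members-bound (∁ S) unique (All.map x∉p⇒x∈∁p xs∉S)))
          (≤-reflexive (complement-size S))

covering-bound : ∀ (S : Subset n) xs → (∀ {y} → y ∉ S → y ∈ˡ xs) → n ≤ ∣ S ∣ + length xs
covering-bound S xs covers =
  ≤-trans (≤-reflexive (≡-sym (complement-size S)))
          (+-monoʳ-≤ ∣ S ∣ (covered-bound (∁ S) xs (λ y∈∁S → covers (x∈∁p⇒x∉p y∈∁S))))

without : List (Fin n) → Subset n
without []       = ⊤
without (x ∷ xs) = without xs - x

∈-without⁻ : ∀ (xs : List (Fin n)) {y} → y ∈ without xs → y ∉ˡ xs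
∈-without⁻ (x ∷ xs) y∈ (here refl)  = x∈p─q⇒x∉q (without xs) ⁅ x ⁆ y∈ (x∈⁅x⁆ x)
∈-without⁻ (x ∷ xs) y∈ (there y∈xs) = ∈-without⁻ xs (p─q⊆p (without xs) ⁅ x ⁆ y∈) y∈xs

∈-without⁺ : ∀ (xs : List (Fin n)) {y} → y ∉ˡ xs → y ∈ without xs
∈-without⁺ []       y∉xs = ∈⊤
∈-without⁺ (x ∷ xs) y∉xs = x∈p∧x≢y⇒x∈p-y (∈-without⁺ xs (y∉xs ∘ there)) (y∉xs ∘ here)

without-size : ∀ {xs : List (Fin n)} → Unique xs → ∣ without xs ∣ + length xs ≡ n
without-size {xs = xs} unique = ≤-antisym
  (outside-bound (without xs) unique (All.tabulate λ x∈xs x∈S → ∈-without⁻ xs x∈S x∈xs))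
  (covering-bound (without xs) xs λ {y} y∉S →
     decidable-stable (DecMembership._∈?_ _≟_ y xs) (y∉S ∘ ∈-without⁺ xs))

outside-exhausted : ∀ (S : Subset n) {xs} → Unique xs → All (_∉ S) xs → ∣ S ∣ + length xs ≡ n →
                    ∀ {y} → y ∉ S → y ∈ˡ xs
outside-exhausted {n} S {xs} unique xs∉S size {y} y∉S =
  decidable-stable (DecMembership._∈?_ _≟_ y xs) λ y∉xs →
    <-irrefl size (≤-trans (≤-reflexive (≡-sym (+-suc ∣ S ∣ (length xs))))
                           (outside-bound S (¬Any⇒All¬ xs y∉xs ∷ unique) (y∉S ∷ xs∉S)))

unlisted-outside : ∀ (S : Subset n) xs → ∣ S ∣ + length xs < n → ∃ λ c → c ∉ S × c ∉ˡ xs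
unlisted-outside {n} S xs small with ¬∀⟶∃¬ n Listed listed? all-listed
  where
  Listed : Fin n → Set
  Listed c = c ∉ S → c ∈ˡ xs
  listed? : Decidable Listed
  listed? c = ¬? (c ∈? S) →-dec DecMembership._∈?_ _≟_ c xs
  all-listed : ¬ (∀ c → Listed c)
  all-listed listed = <⇒≱ small (covering-bound S xs (listed _))
... | c , unlisted = c , (λ c∈S → unlisted λ c∉S → ⊥-elim (c∉S c∈S)) , (λ c∈xs → unlisted λ _ → c∈xs)

gap-absurd : ∀ {m n j k} → n ≤ m + j → m + k ≡ n → j < k → ⊥
gap-absurd {m} {j = j} {k} n≤m+j m+k≡n j<k =
  <⇒≱ j<k (+-cancelˡ-≤ m k j (≤-trans (≤-reflexive m+k≡n) n≤m+j))

next-step : ∀ {m n k} → m + k ≤ n → m + k ≢ n → m + suc k ≤ n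
next-step {m} {k = k} le ne = ≤-trans (≤-reflexive (+-suc m k)) (≤∧≢⇒< le ne)

module PowerDomination {n : ℕ} (G : SimpleGraph n) where

  adj-sym : ∀ {u v} → Adj G u v ≡ true → Adj G v u ≡ true
  adj-sym {u} {v} uv = trans (sym G v u) uv

  nonadj-sym : ∀ {u v} → Adj G u v ≡ false → Adj G v u ≡ false
  nonadj-sym {u} {v} uv = trans (sym G v u) uv

  adj⇒≢ : ∀ {u v} → Adj G u v ≡ true → u ≢ v
  adj⇒≢ {u} uu refl with trans (≡-sym uu) (irref G u)
  ... | ()

  adj-and-nonadj : ∀ {u v} → Adj G u v ≡ true → Adj G u v ≡ false → ⊥
  adj-and-nonadj uv ¬uv with trans (≡-sym uv) ¬uv
  ... | ()

  Dominated : Subset n → Fin n → Set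
  Dominated = P G 0

  dominated? : ∀ S → Decidable (Dominated S)
  dominated? S y = any? λ v → (v ∈? S) ×-dec ((y ≟ v) ⊎-dec (Adj G v y ≟ᵇ true))

  undominated⇒∉S : ∀ {S x} → ¬ Dominated S x → x ∉ S
  undominated⇒∉S ¬dom x∈S = ¬dom (_ , x∈S , inj₁ refl)

  undominated-nbr∉S : ∀ {S x y} → ¬ Dominated S x → Adj G x y ≡ true → y ∉ S
  undominated-nbr∉S ¬dom xy y∈S = ¬dom (_ , y∈S , inj₂ (adj-sym xy))

  dominated⇒observed : ∀ {S y} i → Dominated S y → P G i S y
  dominated⇒observed zero    dom = dom
  dominated⇒observed (suc i) dom = inj₁ (dominated⇒observed i dom)

  unobserved⇒undominated : ∀ {S w} → ¬ P∞ G S w → ¬ Dominated S w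
  unobserved⇒undominated ¬obs dom = ¬obs (0 , dom)

  forcing : ∀ {S i x u} → P G i S x → InN[_] G x u → ¬ P G i S u →
            (∀ y → InN[_] G x y → y ≢ u → P G i S y) → P G (suc i) S u
  forcing {u = u} obs-x xu ¬obs-u others =
    inj₂ (_ , obs-x , xu , ¬obs-u , λ y xy ¬obs-y → decidable-stable (y ≟ u) (¬obs-y ∘ others y xy))

  another-undominated-neighbour : ∀ {S i x u} → P G i S x → Adj G x u ≡ true → ¬ P∞ G S u →
    ∃ λ y → Adj G x y ≡ true × y ≢ u × ¬ Dominated S y
  another-undominated-neighbour {S} {i} {x} {u} obs-x xu ¬obs-u
    with ¬∀⟶∃¬ n Harmless harmless? all-harmless
    where
    Harmless : Fin n → Set
    Harmless y = Adj G x y ≡ true → y ≢ u → Dominated S y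
    harmless? : Decidable Harmless
    harmless? y = (Adj G x y ≟ᵇ true) →-dec (¬? (y ≟ u) →-dec dominated? S y)
    all-harmless : ¬ (∀ y → Harmless y)
    all-harmless harmless =
      ¬obs-u (suc i , forcing obs-x (inj₂ xu) (λ obs-u → ¬obs-u (i , obs-u)) others)
      where
      others : ∀ y → InN[_] G x y → y ≢ u → P G i S y
      others y (inj₁ refl) _   = obs-x
      others y (inj₂ xy)   y≢u = dominated⇒observed i (harmless y xy y≢u)
  ... | y , ¬harmless =
    y , adjacent , (λ y≡u → ¬harmless λ _ y≢u → ⊥-elim (y≢u y≡u)) , (λ dom → ¬harmless λ _ _ → dom)
    where
    adjacent : Adj G x y ≡ true
    adjacent = decidable-stable (Adj G x y ≟ᵇ true) λ ¬xy → ¬harmless λ xy → ⊥-elim (¬xy xy)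

  IsFort : List (Fin n) → Set
  IsFort B = ∀ {v w} → v ∉ˡ B → w ∈ˡ B → Adj G v w ≡ true →
             ∃ λ w' → w' ∈ˡ B × w' ≢ w × Adj G v w' ≡ true

  -- A fort disjoint from N[S] stays unobserved at every stage:
  -- no vertex outside the fort can ever force a vertex of it.
  fort-unobserved : ∀ {S B} → IsFort B → (∀ {w} → w ∈ˡ B → ¬ Dominated S w) →
                    ∀ i {w} → w ∈ˡ B → ¬ P G i S w
  fort-unobserved fort undominated zero    w∈B dom = undominated w∈B dom
  fort-unobserved fort undominated (suc i) w∈B (inj₁ obs) = fort-unobserved fort undominated i w∈B obs
  fort-unobserved fort undominated (suc i) w∈B (inj₂ (v , obs-v , vw , _ , unique)) with vw
  ... | inj₁ refl = fort-unobserved fort undominated i w∈B obs-v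
  ... | inj₂ adj with fort (λ v∈B → fort-unobserved fort undominated i v∈B obs-v) w∈B adj
  ... | w' , w'∈B , w'≢w , adj' =
    w'≢w (unique w' (inj₂ adj') (fort-unobserved fort undominated i w'∈B))

  fort-FPDS : ∀ {B T b} → Unique T → IsFort B → b ∈ˡ B →
              (∀ {w} → w ∈ˡ B → w ∈ˡ T) → (∀ {w v} → w ∈ˡ B → Adj G w v ≡ true → v ∈ˡ T) →
              ∃ λ S → IsFPDS G S × ∣ S ∣ + length T ≡ n
  fort-FPDS {B} {T} {b} unique fort b∈B B⊆T nbrs⊆T =
    without T , (b , λ { (i , obs) → fort-unobserved fort undominated i b∈B obs }) ,
    without-size unique
    where
    undominated : ∀ {w} → w ∈ˡ B → ¬ Dominated (without T) w
    undominated w∈B (v , v∈S , inj₁ refl) = ∈-without⁻ T v∈S (B⊆T w∈B)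
    undominated w∈B (v , v∈S , inj₂ vw)   = ∈-without⁻ T v∈S (nbrs⊆T w∈B (adj-sym vw))

  -- Every FPDS misses its unobserved vertex, so it has at most n - 1 elements.
  FPDS-bound : ∀ {S} → IsFPDS G S → ∣ S ∣ + 1 ≤ n
  FPDS-bound {S} (w , unobserved) =
    outside-bound S ([] ∷ []) (undominated⇒∉S (unobserved⇒undominated unobserved) ∷ [])

  -- An isolated vertex v is a fort; omitting it leaves an FPDS of size n - 1.
  isolated⇒FPDS : HasIsolatedVertex G → ∃ λ S → IsFPDS G S × ∣ S ∣ + 1 ≡ n
  isolated⇒FPDS (v , isolated) = fort-FPDS ([] ∷ []) fort (here refl) id nbrs
    where
    fort : IsFort (v ∷ [])
    fort _ (here refl) adj = ⊥-elim (adj-and-nonadj (adj-sym adj) (isolated _))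
    nbrs : ∀ {w y} → w ∈ˡ v ∷ [] → Adj G w y ≡ true → y ∈ˡ v ∷ []
    nbrs (here refl) adj = ⊥-elim (adj-and-nonadj adj (isolated _))

  -- A K₂ component {u , v} is a fort; omitting it leaves an FPDS of size n - 2.
  K2⇒FPDS : HasK2Component G → ∃ λ S → IsFPDS G S × ∣ S ∣ + 2 ≡ n
  K2⇒FPDS (u , v , uv , u-nbrs , v-nbrs) =
    fort-FPDS ((adj⇒≢ uv ∷ []) ∷ [] ∷ []) fort (here refl) id nbrs
    where
    fort : IsFort (u ∷ v ∷ [])
    fort y∉B (here refl)         adj = ⊥-elim (y∉B (there (here (u-nbrs _ (adj-sym adj)))))
    fort y∉B (there (here refl)) adj = ⊥-elim (y∉B (here (v-nbrs _ (adj-sym adj))))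
    nbrs : ∀ {w y} → w ∈ˡ u ∷ v ∷ [] → Adj G w y ≡ true → y ∈ˡ u ∷ v ∷ []
    nbrs (here refl)         adj = there (here (u-nbrs _ adj))
    nbrs (there (here refl)) adj = here (v-nbrs _ adj)

  -- The two ends {a , c} of a pendant P₃ a - b - c, and the two private vertices {a , b}
  -- of a pendant K₃, are forts; omitting the three vertices leaves an FPDS of size n - 3.
  pendant⇒FPDS : HasPendantP3orK3 G → ∃ λ S → IsFPDS G S × ∣ S ∣ + 3 ≡ n
  pendant⇒FPDS (a , b , c , inj₁ (a≢c , ab , bc , ¬ac , a-nbrs , c-nbrs)) =
    fort-FPDS abc-distinct fort (here refl) ends⊆abc nbrs
    where
    abc-distinct : Unique (a ∷ b ∷ c ∷ [])
    abc-distinct = (adj⇒≢ ab ∷ a≢c ∷ []) ∷ (adj⇒≢ bc ∷ []) ∷ [] ∷ []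
    fort : IsFort (a ∷ c ∷ [])
    fort _ (here refl) adj with a-nbrs _ (adj-sym adj)
    ... | refl = c , there (here refl) , (λ c≡a → a≢c (≡-sym c≡a)) , bc
    fort _ (there (here refl)) adj with c-nbrs _ (adj-sym adj)
    ... | refl = a , here refl , a≢c , adj-sym ab
    ends⊆abc : ∀ {w} → w ∈ˡ a ∷ c ∷ [] → w ∈ˡ a ∷ b ∷ c ∷ []
    ends⊆abc (here refl)         = here refl
    ends⊆abc (there (here refl)) = there (there (here refl))
    nbrs : ∀ {w y} → w ∈ˡ a ∷ c ∷ [] → Adj G w y ≡ true → y ∈ˡ a ∷ b ∷ c ∷ []
    nbrs (here refl)         adj = there (here (a-nbrs _ adj))
    nbrs (there (here refl)) adj = there (here (c-nbrs _ adj))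
  pendant⇒FPDS (a , b , c , inj₂ (ab , bc , ac , a-nbrs , b-nbrs)) =
    fort-FPDS abc-distinct fort (here refl) ∈-++⁺ˡ nbrs
    where
    abc-distinct : Unique (a ∷ b ∷ c ∷ [])
    abc-distinct = (adj⇒≢ ab ∷ adj⇒≢ ac ∷ []) ∷ (adj⇒≢ bc ∷ []) ∷ [] ∷ []
    fort : IsFort (a ∷ b ∷ [])
    fort y∉B (here refl) adj with a-nbrs _ (adj-sym adj)
    ... | inj₁ refl = ⊥-elim (y∉B (there (here refl)))
    ... | inj₂ refl = b , there (here refl) , (λ b≡a → adj⇒≢ ab (≡-sym b≡a)) , adj-sym bc
    fort y∉B (there (here refl)) adj with b-nbrs _ (adj-sym adj)
    ... | inj₁ refl = ⊥-elim (y∉B (here refl))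
    ... | inj₂ refl = a , here refl , adj⇒≢ ab , adj-sym ac
    nbrs : ∀ {w y} → w ∈ˡ a ∷ b ∷ [] → Adj G w y ≡ true → y ∈ˡ a ∷ b ∷ c ∷ []
    nbrs (here refl) adj with a-nbrs _ adj
    ... | inj₁ refl = there (here refl)
    ... | inj₂ refl = there (there (here refl))
    nbrs (there (here refl)) adj with b-nbrs _ adj
    ... | inj₁ refl = here refl
    ... | inj₂ refl = there (there (here refl))

  some-neighbour : ¬ HasIsolatedVertex G → ∀ w → ∃ λ v → Adj G w v ≡ true
  some-neighbour ¬isolated w
    with ¬∀⟶∃¬ n (λ v → Adj G w v ≡ false) (λ v → Adj G w v ≟ᵇ false) (¬isolated ∘ (w ,_))
  ... | v , ¬wv = v , ¬-not ¬wv

  -- An FPDS missing a single vertex w: w has no neighbour, since it would lie in S.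
  FPDS⇒isolated : ∀ S → IsFPDS G S → ∣ S ∣ + 1 ≡ n → HasIsolatedVertex G
  FPDS⇒isolated S (w , unobserved) size = w , λ y → ¬-not (no-neighbour y)
    where
    undominated : ¬ Dominated S w
    undominated = unobserved⇒undominated unobserved
    listed : ∀ {y} → y ∉ S → y ∈ˡ w ∷ []
    listed = outside-exhausted S ([] ∷ []) (undominated⇒∉S undominated ∷ []) size
    no-neighbour : ∀ y → Adj G w y ≢ true
    no-neighbour y wy with listed (undominated-nbr∉S undominated wy)
    ... | here refl = adj⇒≢ wy refl

  -- An FPDS missing exactly the unobserved w and a neighbour v: v is not dominated
  -- (it would force w), so {w , v} is a K₂ component.
  FPDS⇒K2 : ∀ S → IsFPDS G S → ∣ S ∣ + 2 ≡ n → ¬ HasIsolatedVertex G → HasK2Component G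
  FPDS⇒K2 S (w , unobserved) size ¬isolated with some-neighbour ¬isolated w
  ... | v , wv = w , v , wv , w-nbrs , v-nbrs
    where
    w-undominated : ¬ Dominated S w
    w-undominated = unobserved⇒undominated unobserved
    listed : ∀ {y} → y ∉ S → y ∈ˡ w ∷ v ∷ []
    listed = outside-exhausted S ((adj⇒≢ wv ∷ []) ∷ [] ∷ [])
      (undominated⇒∉S w-undominated ∷ undominated-nbr∉S w-undominated wv ∷ []) size
    v-undominated : ¬ Dominated S v
    v-undominated dom with another-undominated-neighbour {i = 0} dom (adj-sym wv) unobserved
    ... | y , vy , y≢w , y-undominated with listed (undominated⇒∉S y-undominated)
    ... | here refl         = y≢w refl
    ... | there (here refl) = adj⇒≢ vy refl
    w-nbrs : ∀ y → Adj G w y ≡ true → y ≡ v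
    w-nbrs y wy with listed (undominated-nbr∉S w-undominated wy)
    ... | here refl        = ⊥-elim (adj⇒≢ wy refl)
    ... | there (here y≡v) = y≡v
    v-nbrs : ∀ y → Adj G v y ≡ true → y ≡ w
    v-nbrs y vy with listed (undominated-nbr∉S v-undominated vy)
    ... | here y≡w         = y≡w
    ... | there (here refl) = ⊥-elim (adj⇒≢ vy refl)

  not-second : ∀ {x y t z} → Adj G x y ≡ true → Adj G x z ≡ false → y ≡ t ⊎ y ≡ z → y ≡ t
  not-second xy ¬xz (inj₁ y≡t)  = y≡t
  not-second xy ¬xz (inj₂ refl) = ⊥-elim (adj-and-nonadj xy ¬xz)

  not-first : ∀ {x y t z} → Adj G x y ≡ true → Adj G x t ≡ false → y ≡ t ⊎ y ≡ z → y ≡ z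
  not-first xy ¬xt = not-second xy ¬xt ∘ swap

  module ThreeOutside {S w v c} (unobserved : ¬ P∞ G S w) (wv : Adj G w v ≡ true)
      (w≢c : w ≢ c) (v≢c : v ≢ c) (listed : ∀ {y} → y ∉ S → y ∈ˡ w ∷ v ∷ c ∷ [])
      (¬K2 : ¬ HasK2Component G) where

    w-undominated : ¬ Dominated S w
    w-undominated = unobserved⇒undominated unobserved

    w-nbrs : ∀ {y} → Adj G w y ≡ true → y ≡ v ⊎ y ≡ c
    w-nbrs wy with listed (undominated-nbr∉S w-undominated wy)
    ... | here refl                 = ⊥-elim (adj⇒≢ wy refl)
    ... | there (here y≡v)          = inj₁ y≡v
    ... | there (there (here y≡c))  = inj₂ y≡c

    v-nbrs : ¬ Dominated S v → ∀ {y} → Adj G v y ≡ true → y ≡ w ⊎ y ≡ c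
    v-nbrs v-undominated vy with listed (undominated-nbr∉S v-undominated vy)
    ... | here y≡w                  = inj₁ y≡w
    ... | there (here refl)         = ⊥-elim (adj⇒≢ vy refl)
    ... | there (there (here y≡c))  = inj₂ y≡c

    c-nbrs : ¬ Dominated S c → ∀ {y} → Adj G c y ≡ true → y ≡ w ⊎ y ≡ v
    c-nbrs c-undominated cy with listed (undominated-nbr∉S c-undominated cy)
    ... | here y≡w                  = inj₁ y≡w
    ... | there (here y≡v)          = inj₂ y≡v
    ... | there (there (here refl)) = ⊥-elim (adj⇒≢ cy refl)

    -- If c is dominated, v is never observed: otherwise v would force w.
    v-unobserved : Dominated S c → ¬ P∞ G S v
    v-unobserved c-dominated (i , v-observed)
      with another-undominated-neighbour v-observed (adj-sym wv) unobserved
    ... | y , vy , y≢w , y-undominated with listed (undominated⇒∉S y-undominated)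
    ... | here refl                 = y≢w refl
    ... | there (here refl)         = adj⇒≢ vy refl
    ... | there (there (here refl)) = y-undominated c-dominated

    -- c is undominated when it hangs off w alone: otherwise it would force w.
    c-undominated-off-w : Adj G w c ≡ true → Adj G v c ≡ false → ¬ Dominated S c
    c-undominated-off-w wc ¬vc c-dominated
      with another-undominated-neighbour {i = 0} c-dominated (adj-sym wc) unobserved
    ... | y , cy , y≢w , y-undominated with listed (undominated⇒∉S y-undominated)
    ... | here refl                 = y≢w refl
    ... | there (here refl)         = adj-and-nonadj cy (nonadj-sym ¬vc)
    ... | there (there (here refl)) = adj⇒≢ cy refl

    -- c is undominated when it hangs off v alone: otherwise it would force v.
    c-undominated-off-v : Adj G w c ≡ false → Adj G v c ≡ true → ¬ Dominated S c
    c-undominated-off-v ¬wc vc c-dominated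
      with another-undominated-neighbour {i = 0} c-dominated (adj-sym vc) (v-unobserved c-dominated)
    ... | y , cy , y≢v , y-undominated with listed (undominated⇒∉S y-undominated)
    ... | here refl                 = adj-and-nonadj cy (nonadj-sym ¬wc)
    ... | there (here refl)         = y≢v refl
    ... | there (there (here refl)) = adj⇒≢ cy refl

    through-v : ¬ Dominated S c → Adj G v c ≡ true → HasPendantP3orK3 G
    through-v c-undominated vc with Adj G w c in wc
    ... | true  = w , c , v , inj₂ (wc , adj-sym vc , wv ,
                    (λ _ → swap ∘ w-nbrs) , (λ _ → c-nbrs c-undominated))
    ... | false = w , v , c , inj₁ (w≢c , wv , vc , wc ,
                    (λ _ wy → not-second wy wc (w-nbrs wy)) ,
                    (λ _ cy → not-first cy (nonadj-sym wc) (c-nbrs c-undominated cy)))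

    v-undominated-case : ¬ Dominated S v → HasPendantP3orK3 G
    v-undominated-case v-undominated with Adj G w c in wc | Adj G v c in vc
    ... | true  | true  = w , v , c , inj₂ (wv , vc , wc ,
                            (λ _ → w-nbrs) , (λ _ → v-nbrs v-undominated))
    ... | true  | false = v , w , c , inj₁ (v≢c , adj-sym wv , wc , vc ,
                            (λ _ vy → not-second vy vc (v-nbrs v-undominated vy)) ,
                            (λ _ cy → not-second cy (nonadj-sym vc)
                                        (c-nbrs (c-undominated-off-w wc vc) cy)))
    ... | false | true  = through-v (c-undominated-off-v wc vc) vc
    ... | false | false = ⊥-elim (¬K2 (w , v , wv ,
                            (λ _ wy → not-second wy wc (w-nbrs wy)) ,
                            (λ _ vy → not-second vy vc (v-nbrs v-undominated vy))))

    -- If v is dominated, it has a second undominated neighbour, necessarily c.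
    pendant : HasPendantP3orK3 G
    pendant with dominated? S v
    ... | no v-undominated = v-undominated-case v-undominated
    ... | yes v-dominated
      with another-undominated-neighbour {i = 0} v-dominated (adj-sym wv) unobserved
    ... | y , vy , y≢w , y-undominated with listed (undominated⇒∉S y-undominated)
    ... | here refl                 = ⊥-elim (y≢w refl)
    ... | there (here refl)         = ⊥-elim (adj⇒≢ vy refl)
    ... | there (there (here refl)) = through-v y-undominated vy

  FPDS⇒pendant : ∀ S → IsFPDS G S → ∣ S ∣ + 3 ≡ n →
                 ¬ HasIsolatedVertex G → ¬ HasK2Component G → HasPendantP3orK3 G
  FPDS⇒pendant S (w , unobserved) size ¬isolated ¬K2 with some-neighbour ¬isolated w
  ... | v , wv
    with unlisted-outside S (w ∷ v ∷ []) (≤-reflexive (trans (≡-sym (+-suc ∣ S ∣ 2)) size))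
  ... | c , c∉S , c∉wv = ThreeOutside.pendant unobserved wv w≢c v≢c listed ¬K2
    where
    w-undominated : ¬ Dominated S w
    w-undominated = unobserved⇒undominated unobserved
    w≢c : w ≢ c
    w≢c w≡c = c∉wv (here (≡-sym w≡c))
    v≢c : v ≢ c
    v≢c v≡c = c∉wv (there (here (≡-sym v≡c)))
    listed : ∀ {y} → y ∉ S → y ∈ˡ w ∷ v ∷ c ∷ []
    listed = outside-exhausted S ((adj⇒≢ wv ∷ w≢c ∷ []) ∷ (v≢c ∷ []) ∷ [] ∷ [])
      (undominated⇒∉S w-undominated ∷ undominated-nbr∉S w-undominated wv ∷ c∉S ∷ []) size

  module FailedNumber (m : ℕ) (isNumber : IsFailedPDNumber G m) where

    S₀ : Subset n
    S₀ = proj₁ (proj₁ isNumber)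

    S₀-failed : IsFPDS G S₀
    S₀-failed = proj₁ (proj₂ (proj₁ isNumber))

    S₀-size : ∣ S₀ ∣ ≡ m
    S₀-size = proj₂ (proj₂ (proj₁ isNumber))

    at-maximum : ∀ {k} → m + k ≡ n → ∣ S₀ ∣ + k ≡ n
    at-maximum {k} = trans (cong (_+ k) S₀-size)

    n≤m+ : ∀ {k} → (∃ λ S → IsFPDS G S × ∣ S ∣ + k ≡ n) → n ≤ m + k
    n≤m+ {k} (S , failed , size) =
      ≤-trans (≤-reflexive (≡-sym size)) (+-monoˡ-≤ k (proj₂ isNumber S failed))

    m+1≤n : m + 1 ≤ n
    m+1≤n = subst (λ s → s + 1 ≤ n) S₀-size (FPDS-bound S₀-failed)

    -- Each part: the extraction at S₀ gives one direction; the construction together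
    -- with the upper bound m + k ≤ n (from the failure of the previous parts) the other.

    part₁ : (m + 1 ≡ n) ⇔ HasIsolatedVertex G
    part₁ = mk⇔ (FPDS⇒isolated S₀ S₀-failed ∘ at-maximum)
                (λ isolated → ≤-antisym m+1≤n (n≤m+ (isolated⇒FPDS isolated)))

    m+2≤n : ¬ HasIsolatedVertex G → m + 2 ≤ n
    m+2≤n ¬isolated = next-step m+1≤n (¬isolated ∘ Equivalence.to part₁)

    part₂ : (m + 2 ≡ n) ⇔ (HasK2Component G × ¬ HasIsolatedVertex G)
    part₂ = mk⇔ to (λ (K2 , ¬isolated) → ≤-antisym (m+2≤n ¬isolated) (n≤m+ (K2⇒FPDS K2)))
      where
      to : m + 2 ≡ n → HasK2Component G × ¬ HasIsolatedVertex G
      to size = FPDS⇒K2 S₀ S₀-failed (at-maximum size) ¬isolated , ¬isolated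
        where
        ¬isolated : ¬ HasIsolatedVertex G
        ¬isolated isolated = gap-absurd (n≤m+ (isolated⇒FPDS isolated)) size (n<1+n 1)

    m+3≤n : ¬ HasIsolatedVertex G → ¬ HasK2Component G → m + 3 ≤ n
    m+3≤n ¬isolated ¬K2 = next-step (m+2≤n ¬isolated) (¬K2 ∘ proj₁ ∘ Equivalence.to part₂)

    part₃ : (m + 3 ≡ n) ⇔ (¬ HasIsolatedVertex G × ¬ HasK2Component G × HasPendantP3orK3 G)
    part₃ = mk⇔ to (λ (¬isolated , ¬K2 , pendant) →
                      ≤-antisym (m+3≤n ¬isolated ¬K2) (n≤m+ (pendant⇒FPDS pendant)))
      where
      to : m + 3 ≡ n → ¬ HasIsolatedVertex G × ¬ HasK2Component G × HasPendantP3orK3 G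
      to size = ¬isolated , ¬K2 , FPDS⇒pendant S₀ S₀-failed (at-maximum size) ¬isolated ¬K2
        where
        ¬isolated : ¬ HasIsolatedVertex G
        ¬isolated isolated = gap-absurd (n≤m+ (isolated⇒FPDS isolated)) size (s≤s (s≤s z≤n))
        ¬K2 : ¬ HasK2Component G
        ¬K2 K2 = gap-absurd (n≤m+ (K2⇒FPDS K2)) size (n<1+n 2)

theorem2 : ∀ {n} (G : SimpleGraph n) (m : ℕ) → IsFailedPDNumber G m →
    ((m + 1 ≡ n) ⇔ HasIsolatedVertex G) ×
    ((m + 2 ≡ n) ⇔ (HasK2Component G × ¬ HasIsolatedVertex G)) ×
    ((m + 3 ≡ n) ⇔ (¬ HasIsolatedVertex G × ¬ HasK2Component G × HasPendantP3orK3 G))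
theorem2 G m isNumber = part₁ , part₂ , part₃
  where open PowerDomination.FailedNumber G m isNumber
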